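{- There exists a pair of distinct input sequences $s,s'\in\{0,1\}^*$ such that for every query sequence $q$ over $\{0,1\}$, $d_{\mathrm{DTW}}(s,q)=d_{\mathrm{DTW}}(s',q)$; that is, $s$ and $s'$ cannot be distinguished by DTW distance queries without extra characters.
   Context: An expansion of a sequence $x$ is any sequence obtained from $x$ by replacing each character by one or more consecutive copies of itself. For sequences $x,y$ (of real numbers), $d_{\mathrm{DTW}}(x,y)=\min\|\bar x-\bar y\|_1$, the minimum over all pairs $(\bar x,\bar y)$ of equal-length expansions of $x$ and $y$. -}

module Defs where

open import Data.Bool using (Bool; true; false; _xor_)
open import Data.Nat using (ℕ; zero; suc; _+_; _≤_)
open import Data.List using (List; []; _∷_; _++_; replicate; length)
open import Data.Product using (Σ; _×_; _,_)
open import Relation.Binary.PropositionalEquality using (_≡_)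

-- Binary sequences: elements of {0,1}^*, with 0 = false, 1 = true.
BinSeq : Set
BinSeq = List Bool

absDiff : Bool → Bool → ℕ
absDiff a b with a xor b
... | true  = 1
... | false = 0

-- ℓ1 distance of two sequences (only meaningful for equal lengths;
-- equal length is required separately where it is used).
l1 : BinSeq → BinSeq → ℕ
l1 (a ∷ x) (b ∷ y) = absDiff a b + l1 x y
l1 _ _ = 0

data Expansion : BinSeq → BinSeq → Set where
  exp-[] : Expansion [] []
  exp-∷  : ∀ {a x x̄} (k : ℕ) → Expansion x x̄ →
           Expansion (a ∷ x) (replicate (suc k) a ++ x̄)

Warp : BinSeq → BinSeq → ℕ → Set
Warp x y c = Σ BinSeq λ x̄ → Σ BinSeq λ ȳ →
  Expansion x x̄ × Expansion y ȳ × length x̄ ≡ length ȳ × l1 x̄ ȳ ≡ c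

IsDTW : BinSeq → BinSeq → ℕ → Set
IsDTW x y d = Warp x y d × (∀ c → Warp x y c → d ≤ c)

{-# OPTIONS --safe #-}
-- d_DTW(s, q) and d_DTW(s′, q) are minima over the same set of costs: every warp of s against q
-- turns into a warp of s′ against q of equal cost, and vice versa. A warp of x against q amounts
-- to an expansion of q cut into nonempty blocks, one per letter of x, the cost counting the
-- letters that differ from the letter of x owning their block. For s = 010110 and its mirror
-- image s′ = 011010 a decomposition for s is converted as follows. If the block of the first 1
-- has two letters or more, it is split between the two 1s of s′, and the blocks of the last two
-- 1s of s are merged; a lone 1 there is first duplicated, for free. A lone 0 there costs 1; it
-- joins the surrounding 0s instead, and the first letter b of the block of the fifth letter of s
-- is tripled and aligned with 1, 0, 1, which costs |1 − b| + |0 − b| = 1 more. The converse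
-- is the mirror image of this argument.
module Submission where

open import Defs
open import Data.Bool using (Bool; true; false)
open import Data.Nat using (ℕ; zero; suc; _+_)
open import Data.Nat.Properties using (+-assoc; suc-injective)
open import Data.Nat.Tactic.RingSolver using (solve-∀)
open import Data.List using (List; []; _∷_; _++_; replicate; length)
open import Data.List.Properties using (++-assoc; length-++; length-replicate)
open import Data.List.NonEmpty using (List⁺; _∷_; [_]; toList; _⁺++⁺_)
open import Data.Product using (Σ; ∃₂; _×_; _,_)
open import Function using (_∘_; _∋_)
open import Function.Bundles using (_⇔_; mk⇔)
open import Relation.Binary.PropositionalEquality using (_≡_; refl; sym; trans; cong; cong₂; subst; module ≡-Reasoning)
open import Relation.Nullary using (¬_)

private variable
  a b : Bool
  x x′ x″ x̄ q ȳ Z Z′ : BinSeq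
  c d : ℕ

++-split : {A B : Set} (xs : List A) {ys : List A} {zs : List B} → length (xs ++ ys) ≡ length zs →
  ∃₂ λ zs₁ zs₂ → zs ≡ zs₁ ++ zs₂ × length xs ≡ length zs₁ × length ys ≡ length zs₂
++-split [] eq = [] , _ , refl , refl , eq
++-split (x ∷ xs) {zs = z ∷ zs} eq with ++-split xs {zs = zs} (suc-injective eq)
... | zs₁ , zs₂ , refl , eq₁ , eq₂ = z ∷ zs₁ , zs₂ , refl , cong suc eq₁ , eq₂

l1-++ : ∀ X {X′ Y Y′} → length X ≡ length Y → l1 (X ++ X′) (Y ++ Y′) ≡ l1 X Y + l1 X′ Y′
l1-++ [] {Y = []} refl = refl
l1-++ (a ∷ X) {Y = y ∷ Y} eq =
  trans (cong (absDiff a y +_) (l1-++ X (suc-injective eq))) (sym (+-assoc (absDiff a y) _ _))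

cost : Bool → BinSeq → ℕ
cost a Y = l1 (replicate (length Y) a) Y

cost-++ : ∀ a Y Z → cost a (Y ++ Z) ≡ cost a Y + cost a Z
cost-++ a [] Z = refl
cost-++ a (y ∷ Y) Z =
  trans (cong (absDiff a y +_) (cost-++ a Y Z)) (sym (+-assoc (absDiff a y) _ _))

absDiff-complement : ∀ b → absDiff true b + absDiff false b ≡ 1
absDiff-complement true  = refl
absDiff-complement false = refl

data Stretch : BinSeq → BinSeq → Set where
  done  : Stretch [] []
  keep  : Stretch x x̄ → Stretch (a ∷ x) (a ∷ x̄)
  again : Stretch (a ∷ x) x̄ → Stretch (a ∷ x) (a ∷ x̄)

expansion⇒stretch : Expansion x x̄ → Stretch x x̄
expansion⇒stretch exp-[]      = done
expansion⇒stretch (exp-∷ k e) = repeat k (expansion⇒stretch e)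
  where
  repeat : ∀ k → Stretch x x̄ → Stretch (a ∷ x) (replicate (suc k) a ++ x̄)
  repeat zero    st = keep st
  repeat (suc k) st = again (repeat k st)

stretch⇒expansion : Stretch x x̄ → Expansion x x̄
stretch⇒expansion done       = exp-[]
stretch⇒expansion (keep st)  = exp-∷ 0 (stretch⇒expansion st)
stretch⇒expansion (again st) with stretch⇒expansion st
... | exp-∷ k e = exp-∷ (suc k) e

stretch-dup : Stretch q (b ∷ Z) → Stretch q (b ∷ b ∷ Z)
stretch-dup (keep st)  = again (keep st)
stretch-dup (again st) = again (again st)

stretch-++ˡ : ∀ P → (∀ {q} → Stretch q Z → Stretch q Z′) → Stretch q (P ++ Z) → Stretch q (P ++ Z′)
stretch-++ˡ []      f st         = f st
stretch-++ˡ (p ∷ P) f (keep st)  = keep (stretch-++ˡ P f st)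
stretch-++ˡ (p ∷ P) f (again st) = again (stretch-++ˡ P f st)

infixr 5 _∷_

data Blocks : BinSeq → Set where
  []  : Blocks []
  _∷_ : List⁺ Bool → Blocks x → Blocks (a ∷ x)

private variable
  B B′ B″ : Blocks x

flatten : Blocks x → BinSeq
flatten []      = []
flatten (Y ∷ B) = toList Y ++ flatten B

blocksCost : Blocks x → ℕ
blocksCost []                = 0
blocksCost {a ∷ _} (Y ∷ B) = cost a (toList Y) + blocksCost B

expandAlong : Blocks x → BinSeq
expandAlong []                = []
expandAlong {a ∷ _} (Y ∷ B) = replicate (length (toList Y)) a ++ expandAlong B

expandAlong-expansion : (B : Blocks x) → Expansion x (expandAlong B)
expandAlong-expansion []            = exp-[]
expandAlong-expansion ((_ ∷ Y) ∷ B) = exp-∷ (length Y) (expandAlong-expansion B)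

length-expandAlong : (B : Blocks x) → length (expandAlong B) ≡ length (flatten B)
length-expandAlong []                = refl
length-expandAlong {a ∷ _} (Y ∷ B) = begin
  length (replicate (length (toList Y)) a ++ expandAlong B)  ≡⟨ length-++ (replicate (length (toList Y)) a) ⟩
  length (replicate (length (toList Y)) a) + length (expandAlong B)
    ≡⟨ cong₂ _+_ (length-replicate (length (toList Y))) (length-expandAlong B) ⟩
  length (toList Y) + length (flatten B)                  ≡⟨ length-++ (toList Y) ⟨
  length (toList Y ++ flatten B)                          ∎
  where open ≡-Reasoning

l1-expandAlong : (B : Blocks x) → l1 (expandAlong B) (flatten B) ≡ blocksCost B
l1-expandAlong []                = refl
l1-expandAlong {a ∷ _} (Y ∷ B) =
  trans (l1-++ (replicate (length (toList Y)) a) (length-replicate (length (toList Y))))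
        (cong (cost a (toList Y) +_) (l1-expandAlong B))

Alignment : BinSeq → BinSeq → ℕ → Set
Alignment x q c = Σ (Blocks x) λ B → Stretch q (flatten B) × blocksCost B ≡ c

alignment⇒warp : Alignment x q c → Warp x q c
alignment⇒warp (B , st , refl) =
  expandAlong B , flatten B , expandAlong-expansion B , stretch⇒expansion st , length-expandAlong B , l1-expandAlong B

blocks-of-expansion : Expansion x x̄ → length x̄ ≡ length ȳ →
  Σ (Blocks x) λ B → flatten B ≡ ȳ × blocksCost B ≡ l1 x̄ ȳ
blocks-of-expansion {ȳ = []} exp-[] refl = [] , refl , refl
blocks-of-expansion {ȳ = ȳ} (exp-∷ {a} {x̄ = x̄} k e) len with ++-split (replicate (suc k) a) {zs = ȳ} len
... | [] , _ , _ , () , _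
... | y ∷ Y , Ȳ , refl , len₁ , len₂ with blocks-of-expansion {ȳ = Ȳ} e len₂
...   | B , refl , cost-B = (y ∷ Y) ∷ B , refl , cost-eq
  where
  cost-eq : cost a (y ∷ Y) + blocksCost B ≡ l1 (replicate (suc k) a ++ x̄) (y ∷ Y ++ flatten B)
  cost-eq = trans (cong₂ _+_ (cong (λ n → l1 (replicate n a) (y ∷ Y)) (trans (sym len₁) (length-replicate (suc k))))
                             cost-B)
                  (sym (l1-++ (replicate (suc k) a) len₁))

warp⇒alignment : Warp x q c → Alignment x q c
warp⇒alignment (_ , ȳ , ex , eq , len , refl) with blocks-of-expansion {ȳ = ȳ} ex len
... | B , refl , cost-B = B , expansion⇒stretch eq , cost-B

-- restretch says that flatten B′ arises from flatten B by repeating letters, in the form that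
-- acts directly on stretches of a query.
record _≼_ (B : Blocks x) (B′ : Blocks x′) : Set where
  constructor mk≼
  field
    restretch : ∀ {q} → Stretch q (flatten B) → Stretch q (flatten B′)
    cost-≡    : blocksCost B′ ≡ blocksCost B

record _≅_ (B : Blocks x) (B′ : Blocks x′) : Set where
  constructor mk≅
  field
    flatten-≡ : flatten B ≡ flatten B′
    cost-≡    : blocksCost B ≡ blocksCost B′

≼-trans : B ≼ B′ → B′ ≼ B″ → B ≼ B″
≼-trans (mk≼ f c) (mk≼ g d) = mk≼ (g ∘ f) (trans d c)

≅-sym : B ≅ B′ → B′ ≅ B
≅-sym (mk≅ f c) = mk≅ (sym f) (sym c)

≅⇒≼ : B ≅ B′ → B ≼ B′
≅⇒≼ (mk≅ f c) = mk≼ (subst (Stretch _) f) (sym c)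

realign : (∀ (B : Blocks x) → Σ (Blocks x′) (B ≼_)) → Alignment x q c → Alignment x′ q c
realign move (B , st , refl) with move B
... | B′ , mk≼ f c = B′ , f st , c

s s′ : BinSeq
s  = false ∷ true ∷ false ∷ true ∷ true ∷ false ∷ []
s′ = false ∷ true ∷ true ∷ false ∷ true ∷ false ∷ []

regroup : ∀ Y₁ U V Y₃ Y₄ Y₅ Y₆ →
  (Blocks s ∋ Y₁ ∷ (U ⁺++⁺ V) ∷ Y₃ ∷ Y₄ ∷ Y₅ ∷ Y₆ ∷ []) ≅
  (Blocks s′ ∋ Y₁ ∷ U ∷ V ∷ Y₃ ∷ (Y₄ ⁺++⁺ Y₅) ∷ Y₆ ∷ [])
regroup Y₁ U V Y₃ Y₄ Y₅ Y₆ =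
  mk≅ (cong (toList Y₁ ++_) (trans (++-assoc (toList U) (toList V) _)
         (cong (λ w → toList U ++ toList V ++ toList Y₃ ++ w) (sym (++-assoc (toList Y₄) (toList Y₅) _)))))
      (rearrange (cost false (toList Y₁)) (cost true (toList U)) (cost true (toList V)) (cost false (toList Y₃))
                 (cost true (toList Y₄)) (cost true (toList Y₅)) (cost false (toList Y₆) + 0)
                 (cost-++ true (toList U) (toList V)) (cost-++ true (toList Y₄) (toList Y₅)))
  where
  rearrange : ∀ {m k} a u v c d e f → m ≡ u + v → k ≡ d + e →
    a + (m + (c + (d + (e + f)))) ≡ a + (u + (v + (c + (k + f))))
  rearrange a u v c d e f refl refl = reassoc a u v c d e f
    where
    reassoc : ∀ a u v c d e f →
      a + ((u + v) + (c + (d + (e + f)))) ≡ a + (u + (v + (c + ((d + e) + f))))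
    reassoc = solve-∀

absorb-zero : ∀ Y₁ Y₃ Y₄ b B₅ Y₆ →
  (Blocks s ∋ Y₁ ∷ [ false ] ∷ Y₃ ∷ Y₄ ∷ (b ∷ B₅) ∷ Y₆ ∷ []) ≼
  (Blocks s′ ∋ (Y₁ ⁺++⁺ (false ∷ toList Y₃)) ∷ Y₄ ∷ [ b ] ∷ [ b ] ∷ (b ∷ B₅) ∷ Y₆ ∷ [])
absorb-zero Y₁ Y₃ Y₄ b B₅ Y₆ =
  mk≼
  (subst (Stretch _) (sym (++-assoc (toList Y₁) (false ∷ toList Y₃) (toList Y₄ ++ b ∷ b ∷ b ∷ B₅ ++ toList Y₆ ++ [])))
    ∘ stretch-++ˡ (toList Y₁) (stretch-++ˡ (false ∷ toList Y₃)
        (stretch-++ˡ (toList Y₄) (stretch-dup ∘ stretch-dup))))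
  (rearrange (cost false (toList Y₁)) (cost false (toList Y₃)) (cost true (toList Y₄)) (absDiff true b) (absDiff false b)
            (cost true (b ∷ B₅) + (cost false (toList Y₆) + 0))
            (cost-++ false (toList Y₁) (false ∷ toList Y₃)) (absDiff-complement b))
  where
  rearrange : ∀ {m} a c d p n e → m ≡ a + c → p + n ≡ 1 →
    m + (d + ((p + 0) + ((n + 0) + e))) ≡ a + (1 + (c + (d + e)))
  rearrange a c d p n e refl p+n≡1 =
    trans (reassoc a c d p n e) (cong (λ k → a + (k + (c + (d + e)))) p+n≡1)
    where
    reassoc : ∀ a c d p n e →
      (a + c) + (d + ((p + 0) + ((n + 0) + e))) ≡ a + ((p + n) + (c + (d + e)))
    reassoc = solve-∀

absorb-zero′ : ∀ Y₁ b B₂ Y₃ Y₄ Y₆ →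
  (Blocks s′ ∋ Y₁ ∷ (b ∷ B₂) ∷ Y₃ ∷ Y₄ ∷ [ false ] ∷ Y₆ ∷ []) ≼
  (Blocks s ∋ Y₁ ∷ [ b ] ∷ [ b ] ∷ (b ∷ B₂) ∷ Y₃ ∷ (Y₄ ⁺++⁺ (false ∷ toList Y₆)) ∷ [])
absorb-zero′ Y₁ b B₂ Y₃ Y₄ Y₆ =
  mk≼
  (subst (Stretch _) (cong (λ w → toList Y₁ ++ b ∷ b ∷ b ∷ B₂ ++ toList Y₃ ++ w)
                           (sym (++-assoc (toList Y₄) (false ∷ toList Y₆) [])))
    ∘ stretch-++ˡ (toList Y₁) (stretch-dup ∘ stretch-dup))
  (rearrange (cost false (toList Y₁)) (cost true (b ∷ B₂)) (cost true (toList Y₃)) (cost false (toList Y₄))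
            (cost false (toList Y₆)) (absDiff true b) (absDiff false b)
            (cost-++ false (toList Y₄) (false ∷ toList Y₆)) (absDiff-complement b))
  where
  rearrange : ∀ {m} a v c d f p n → m ≡ d + f → p + n ≡ 1 →
    a + ((p + 0) + ((n + 0) + (v + (c + (m + 0))))) ≡ a + (v + (c + (d + (1 + (f + 0)))))
  rearrange a v c d f p n refl p+n≡1 =
    trans (reassoc a v c d f p n) (cong (λ k → a + (v + (c + (d + (k + (f + 0)))))) p+n≡1)
    where
    reassoc : ∀ a v c d f p n →
      a + ((p + 0) + ((n + 0) + (v + (c + ((d + f) + 0))))) ≡ a + (v + (c + (d + ((p + n) + (f + 0)))))
    reassoc = solve-∀

s-blocks⇒s′-blocks : (B : Blocks s) → Σ (Blocks s′) (B ≼_)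
s-blocks⇒s′-blocks (Y₁ ∷ (y ∷ t ∷ T) ∷ Y₃ ∷ Y₄ ∷ Y₅ ∷ Y₆ ∷ []) =
  Y₁ ∷ [ y ] ∷ (t ∷ T) ∷ Y₃ ∷ (Y₄ ⁺++⁺ Y₅) ∷ Y₆ ∷ [] ,
  ≅⇒≼ (regroup Y₁ [ y ] (t ∷ T) Y₃ Y₄ Y₅ Y₆)
s-blocks⇒s′-blocks (Y₁ ∷ (true ∷ []) ∷ Y₃ ∷ Y₄ ∷ Y₅ ∷ Y₆ ∷ []) =
  Y₁ ∷ [ true ] ∷ [ true ] ∷ Y₃ ∷ (Y₄ ⁺++⁺ Y₅) ∷ Y₆ ∷ [] ,
  ≼-trans (mk≼ (stretch-++ˡ (toList Y₁) stretch-dup) refl) (≅⇒≼ (regroup Y₁ [ true ] [ true ] Y₃ Y₄ Y₅ Y₆))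
s-blocks⇒s′-blocks (Y₁ ∷ (false ∷ []) ∷ Y₃ ∷ Y₄ ∷ (b ∷ B₅) ∷ Y₆ ∷ []) =
  (Y₁ ⁺++⁺ (false ∷ toList Y₃)) ∷ Y₄ ∷ [ b ] ∷ [ b ] ∷ (b ∷ B₅) ∷ Y₆ ∷ [] ,
  absorb-zero Y₁ Y₃ Y₄ b B₅ Y₆

s′-blocks⇒s-blocks : (B : Blocks s′) → Σ (Blocks s) (B ≼_)
s′-blocks⇒s-blocks (Y₁ ∷ Y₂ ∷ Y₃ ∷ Y₄ ∷ (y ∷ t ∷ T) ∷ Y₆ ∷ []) =
  Y₁ ∷ (Y₂ ⁺++⁺ Y₃) ∷ Y₄ ∷ [ y ] ∷ (t ∷ T) ∷ Y₆ ∷ [] ,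
  ≅⇒≼ (≅-sym (regroup Y₁ Y₂ Y₃ Y₄ [ y ] (t ∷ T) Y₆))
s′-blocks⇒s-blocks (Y₁ ∷ Y₂ ∷ Y₃ ∷ Y₄ ∷ (true ∷ []) ∷ Y₆ ∷ []) =
  Y₁ ∷ (Y₂ ⁺++⁺ Y₃) ∷ Y₄ ∷ [ true ] ∷ [ true ] ∷ Y₆ ∷ [] ,
  ≼-trans (mk≼ (stretch-++ˡ (toList Y₁) (stretch-++ˡ (toList Y₂) (stretch-++ˡ (toList Y₃)
                  (stretch-++ˡ (toList Y₄) stretch-dup))))
               refl)
          (≅⇒≼ (≅-sym (regroup Y₁ Y₂ Y₃ Y₄ [ true ] [ true ] Y₆)))
s′-blocks⇒s-blocks (Y₁ ∷ (b ∷ B₂) ∷ Y₃ ∷ Y₄ ∷ (false ∷ []) ∷ Y₆ ∷ []) =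
  Y₁ ∷ [ b ] ∷ [ b ] ∷ (b ∷ B₂) ∷ Y₃ ∷ (Y₄ ⁺++⁺ (false ∷ toList Y₆)) ∷ [] ,
  absorb-zero′ Y₁ b B₂ Y₃ Y₄ Y₆

warp-s⇒s′ : Warp s q c → Warp s′ q c
warp-s⇒s′ = alignment⇒warp ∘ realign s-blocks⇒s′-blocks ∘ warp⇒alignment

warp-s′⇒s : Warp s′ q c → Warp s q c
warp-s′⇒s = alignment⇒warp ∘ realign s′-blocks⇒s-blocks ∘ warp⇒alignment

IsDTW-cong : (∀ {c} → Warp x q c → Warp x′ q c) → (∀ {c} → Warp x′ q c → Warp x q c) →
  IsDTW x q d ⇔ IsDTW x′ q d
IsDTW-cong to from =
  mk⇔ (λ (w , min) → to w , λ c → min c ∘ from) (λ (w , min) → from w , λ c → min c ∘ to)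

mainTheorem9 : Σ BinSeq λ s → Σ BinSeq λ s′ →
    ¬ (s ≡ s′) × ((q : BinSeq) → (d : ℕ) → IsDTW s q d ⇔ IsDTW s′ q d)
mainTheorem9 = s , s′ , (λ ()) , λ q d → IsDTW-cong warp-s⇒s′ warp-s′⇒s
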